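{- A conditional relation $R$ is a conditional bisimulation up-to context if and only if its closure under contextualization $u(R)$ is a conditional bisimulation.
   Context: Composition of $f\colon A\to B$, $g\colon B\to C$ is written $f;g$. Fix a category $\mathbf C$ with distinguished object $0$ and a representative class $\kappa$ of commuting squares: for every commuting square $\alpha_1;\delta_1=\alpha_2;\delta_2$ there are $(\alpha_1,\alpha_2,\beta_1,\beta_2)\in\kappa$ (a commuting square) and $\gamma$ with $\delta_1=\beta_1;\gamma$, $\delta_2=\beta_2;\gamma$; $\kappa(\alpha_1,\alpha_2)$ is the set of $(\beta_1,\beta_2)$ with $(\alpha_1,\alpha_2,\beta_1,\beta_2)\in\kappa$. Conditions over $A$ are defined inductively as $(A,\mathcal Q,S)$, $\mathcal Q\in\{\forall,\exists\}$, $S$ a finite set of pairs $(h,\mathcal A')$ with $h\colon A\to A'$, $\mathcal A'$ a condition over $A'$. For $a\colon A\to B$: $a\models(A,\forall,S)$ iff for all $(h,\mathcal A')\in S$ and all $g$ with $a=h;g$, $g\models\mathcal A'$; $a\models(A,\exists,S)$ iff some $(h,\mathcal A')\in S$ and $g$ satisfy $a=h;g$, $g\models\mathcal A'$. $\mathcal A\models\mathcal B$: every arrow satisfying $\mathcal A$ satisfies $\mathcal B$. Boolean connectives have the standard semantics. Shift along $c\colon A\to B$: $(A,\mathcal Q,S)_{\downarrow c}=(B,\mathcal Q,\{(\beta,\mathcal A'_{\downarrow\alpha})\mid(h,\mathcal A')\in S,(\alpha,\beta)\in\kappa(h,c)\})$; it satisfies $c;d\models\mathcal A\iff d\models\mathcal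 A_{\downarrow c}$. A conditional reactive system is a set $\mathcal S$ of rules $(\ell,r,\mathcal R)$, $\ell,r\colon0\to I$, $\mathcal R$ a condition over $I$. Context step $a\xrightarrow[C]{f,\ \mathcal A}a'$ ($a\colon0\to J$, $f\colon J\to K$, $a'\colon0\to K$, $\mathcal A$ over $K$): there are a rule $(\ell,r,\mathcal R)\in\mathcal S$ and $c\colon I\to K$ with $a;f=\ell;c$, $a'=r;c$, $\mathcal A\models\mathcal R_{\downarrow c}$. A conditional relation is a set of triples $(a,b,\mathcal C)$, $a,b\colon0\to J$, $\mathcal C$ a condition over $J$. $\mathcal D\models\bigvee_{i\in I}\mathcal E_i$ (possibly infinite $I$): every arrow satisfying $\mathcal D$ satisfies some $\mathcal E_i$. $u(R)=\{(a;d,\ b;d,\ \mathcal C_{\downarrow d})\mid(a,b,\mathcal C)\in R,\ a,b\colon0\to J,\ d\colon J\to K\}$. A conditional bisimulation is a conditional relation $R$ such that for each $(a,b,\mathcal C)\in R$ and each context step $a\xrightarrow[C]{f,\ \mathcal A}a'$ there are an index set $I$, context steps $b\xrightarrow[C]{f,\ \mathcal B_i}b'_i$ and conditions $\mathcal C'_i$ with $(a',b'_i,\mathcal C'_i)\in R$ and $\mathcal A\land\mathcal C_{\downarrow f}\models\bigvee_{i\in I}(\mathcal C'_i\land\mathcal B_i)$, and symmetrically for context steps of $b$. A conditional bisimulation up-to context is a conditional relation $R$ such that for each $(a,b,\mathcal C)\in R$ and each context step $a\xrightarrow[C]{f,\ \mathcal A}a'$ there are an index set $I$, context steps $b\xrightarrow[C]{f,\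 \mathcal B_i}b'_i$, and for each $i\in I$ a triple $(a''_i,b''_i,\mathcal C''_i)\in R$ and an arrow $j_i$ with $a'=a''_i;j_i$, $b'_i=b''_i;j_i$, such that $\mathcal A\land\mathcal C_{\downarrow f}\models\bigvee_{i\in I}((\mathcal C''_i)_{\downarrow j_i}\land\mathcal B_i)$; and symmetrically for context steps of $b$ answered by context steps of $a$. -}

module Defs where

open import Level using (Level; suc; _⊔_)
open import Data.Product using (Σ; Σ-syntax; _×_; _,_)
open import Data.Sum using (_⊎_)
open import Data.Unit.Polymorphic using (⊤)
open import Data.Empty.Polymorphic using (⊥)
open import Data.List using (List; []; _∷_; _++_)
open import Data.List.Membership.Propositional using (_∈_)
open import Relation.Binary.PropositionalEquality using (_≡_)

-- Categories (arrow equality is propositional equality).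
-- Composition in diagrammatic order: f ⨾ g  is  "f;g" (first f, then g).

record Cat (ℓ : Level) : Set (suc ℓ) where
  infixl 9 _⨾_
  field
    Obj   : Set ℓ
    Hom   : Obj → Obj → Set ℓ
    id    : ∀ {A} → Hom A A
    _⨾_   : ∀ {A B C} → Hom A B → Hom B C → Hom A C
    idˡ   : ∀ {A B} (f : Hom A B) → id ⨾ f ≡ f
    idʳ   : ∀ {A B} (f : Hom A B) → f ⨾ id ≡ f
    assoc : ∀ {A B C D} (f : Hom A B) (g : Hom B C) (h : Hom C D) →
            (f ⨾ g) ⨾ h ≡ f ⨾ (g ⨾ h)

module Theory {ℓ : Level} (𝒞 : Cat ℓ) where
  open Cat 𝒞

  -- Representative class κ of commuting squares.
  -- κ α₁ α₂ is the (finite) list of pairs (β₁ , β₂) with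
  -- (α₁,α₂,β₁,β₂) ∈ κ; each member is a commuting square.

  Square : ∀ {A B₁ B₂} → Hom A B₁ → Hom A B₂ → Set ℓ
  Square {A} {B₁} {B₂} α₁ α₂ =
    Σ[ D ∈ Obj ] Σ[ β₁ ∈ Hom B₁ D ] Σ[ β₂ ∈ Hom B₂ D ] (α₁ ⨾ β₁ ≡ α₂ ⨾ β₂)

  record RepSquares : Set ℓ where
    field
      κ : ∀ {A B₁ B₂} (α₁ : Hom A B₁) (α₂ : Hom A B₂) → List (Square α₁ α₂)
      representative :
        ∀ {A B₁ B₂ E} (α₁ : Hom A B₁) (α₂ : Hom A B₂)
          (δ₁ : Hom B₁ E) (δ₂ : Hom B₂ E) → α₁ ⨾ δ₁ ≡ α₂ ⨾ δ₂ →
        Σ[ D ∈ Obj ] Σ[ β₁ ∈ Hom B₁ D ] Σ[ β₂ ∈ Hom B₂ D ]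
        Σ[ p ∈ α₁ ⨾ β₁ ≡ α₂ ⨾ β₂ ] Σ[ γ ∈ Hom D E ]
          ((D , β₁ , β₂ , p) ∈ κ α₁ α₂ × δ₁ ≡ β₁ ⨾ γ × δ₂ ≡ β₂ ⨾ γ)

  data Quant : Set where
    ∀Q ∃Q : Quant

  -- (A , 𝒬 , S) with S a finite set (list) of pairs (h , 𝒜') , h : A → A'
  data Cond : Obj → Set ℓ where
    cond : ∀ {A} → Quant → List (Σ[ A' ∈ Obj ] (Hom A A' × Cond A')) → Cond A

  mutual
    Sat : ∀ {A B} → Cond A → Hom A B → Set ℓ
    Sat (cond ∀Q S) a = SatAll S a
    Sat (cond ∃Q S) a = SatAny S a

    SatAll : ∀ {A B} → List (Σ[ A' ∈ Obj ] (Hom A A' × Cond A')) → Hom A B → Set ℓ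
    SatAll [] a = ⊤
    SatAll ((A' , h , 𝒜') ∷ S) a = (∀ g → a ≡ h ⨾ g → Sat 𝒜' g) × SatAll S a

    SatAny : ∀ {A B} → List (Σ[ A' ∈ Obj ] (Hom A A' × Cond A')) → Hom A B → Set ℓ
    SatAny [] a = ⊥
    SatAny ((A' , h , 𝒜') ∷ S) a = (Σ[ g ∈ Hom A' _ ] (a ≡ h ⨾ g × Sat 𝒜' g)) ⊎ SatAny S a

  _⊨_ : ∀ {K} → Cond K → Cond K → Set ℓ
  _⊨_ {K} 𝒜 ℬ = ∀ {L} (k : Hom K L) → Sat 𝒜 k → Sat ℬ k

  EntailsOr : ∀ {K} (𝒜 𝒞′ : Cond K) (I : Set ℓ) (𝒟 ℰ : I → Cond K) → Set ℓ
  EntailsOr {K} 𝒜 𝒞′ I 𝒟 ℰ =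
    ∀ {L} (k : Hom K L) → Sat 𝒜 k → Sat 𝒞′ k → Σ[ i ∈ I ] (Sat (𝒟 i) k × Sat (ℰ i) k)

  module WithReps (R𝒦 : RepSquares) (Z : Obj) where
    open RepSquares R𝒦

    mutual
      shift : ∀ {A B} → Cond A → Hom A B → Cond B
      shift (cond Q S) c = cond Q (shiftList S c)

      shiftList : ∀ {A B} → List (Σ[ A' ∈ Obj ] (Hom A A' × Cond A')) → Hom A B →
                  List (Σ[ D ∈ Obj ] (Hom B D × Cond D))
      shiftList [] c = []
      shiftList ((A' , h , 𝒜') ∷ S) c = shiftSq 𝒜' (κ h c) ++ shiftList S c

      shiftSq : ∀ {A A' B} {h : Hom A A'} {c : Hom A B} → Cond A' →
                List (Square h c) → List (Σ[ D ∈ Obj ] (Hom B D × Cond D))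
      shiftSq 𝒜' [] = []
      shiftSq 𝒜' ((D , α , β , _) ∷ sqs) = (D , β , shift 𝒜' α) ∷ shiftSq 𝒜' sqs

    ReactiveSystem : Set (suc ℓ)
    ReactiveSystem = ∀ {I} → Hom Z I → Hom Z I → Cond I → Set ℓ

    CondRel : Set (suc ℓ)
    CondRel = ∀ {J} → Hom Z J → Hom Z J → Cond J → Set ℓ

    flip : CondRel → CondRel
    flip R a b C = R b a C

    u : CondRel → CondRel
    u R {K} x y D =
      Σ[ J ∈ Obj ] Σ[ a ∈ Hom Z J ] Σ[ b ∈ Hom Z J ] Σ[ C ∈ Cond J ]
      (R a b C × Σ[ d ∈ Hom J K ] (x ≡ a ⨾ d × y ≡ b ⨾ d × D ≡ shift C d))

    module Steps (𝒮 : ReactiveSystem) where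

      record CStep {J K} (a : Hom Z J) (f : Hom J K) (𝒜 : Cond K) (a' : Hom Z K) : Set ℓ where
        field
          I    : Obj
          l r  : Hom Z I
          ℛ    : Cond I
          rule : 𝒮 l r ℛ
          c    : Hom I K
          eqˡ  : a ⨾ f ≡ l ⨾ c
          eqʳ  : a' ≡ r ⨾ c
          ent  : 𝒜 ⊨ shift ℛ c

      BisimHalf : CondRel → Set (suc ℓ)
      BisimHalf R =
        ∀ {J K} {a b : Hom Z J} {C : Cond J} → R a b C →
        ∀ {f : Hom J K} {𝒜 : Cond K} {a' : Hom Z K} → CStep a f 𝒜 a' →
        Σ[ I ∈ Set ℓ ] Σ[ ℬ ∈ (I → Cond K) ] Σ[ b' ∈ (I → Hom Z K) ]
        Σ[ C' ∈ (I → Cond K) ]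
          (((i : I) → CStep b f (ℬ i) (b' i)) ×
           ((i : I) → R a' (b' i) (C' i)) ×
           EntailsOr 𝒜 (shift C f) I C' ℬ)

      IsBisim : CondRel → Set (suc ℓ)
      IsBisim R = BisimHalf R × BisimHalf (flip R)

      UpToHalf : CondRel → Set (suc ℓ)
      UpToHalf R =
        ∀ {J K} {a b : Hom Z J} {C : Cond J} → R a b C →
        ∀ {f : Hom J K} {𝒜 : Cond K} {a' : Hom Z K} → CStep a f 𝒜 a' →
        Σ[ I ∈ Set ℓ ] Σ[ ℬ ∈ (I → Cond K) ] Σ[ b' ∈ (I → Hom Z K) ]
        Σ[ J'' ∈ (I → Obj) ]
        Σ[ a'' ∈ ((i : I) → Hom Z (J'' i)) ] Σ[ b'' ∈ ((i : I) → Hom Z (J'' i)) ]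
        Σ[ C'' ∈ ((i : I) → Cond (J'' i)) ] Σ[ j ∈ ((i : I) → Hom (J'' i) K) ]
          (((i : I) → CStep b f (ℬ i) (b' i)) ×
           ((i : I) → R (a'' i) (b'' i) (C'' i)) ×
           ((i : I) → a' ≡ a'' i ⨾ j i) ×
           ((i : I) → b' i ≡ b'' i ⨾ j i) ×
           EntailsOr 𝒜 (shift C f) I (λ i → shift (C'' i) (j i)) ℬ)

      IsBisimUpToContext : CondRel → Set (suc ℓ)
      IsBisimUpToContext R = UpToHalf R × UpToHalf (flip R)

module Submission where

-- The proof rests on one semantic fact about conditions, the shift lemma
-- d ⊨ 𝒜↓c  ⇔  c;d ⊨ 𝒜, proved by induction on 𝒜; its only non-trivial
-- ingredient is that the representative squares κ(h,c) see exactly the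
-- factorisations g of c;d through h.  From it follow the two laws
-- (𝒜↓d)↓f ≡ 𝒜↓(d;f) and 𝒜 ≡ 𝒜↓id up to satisfaction.
--
-- On the operational side a context step of a;d under f is the same as a
-- context step of a under d;f.  With these facts each half of the
-- bisimulation game transfers directly:
--   * an up-to answer (a''ᵢ , b''ᵢ , 𝒞''ᵢ) ∈ R with arrow jᵢ is literally
--     the triple (a''ᵢ;jᵢ , b''ᵢ;jᵢ , 𝒞''ᵢ↓jᵢ) ∈ u(R), and conversely;
--   * (a , b , 𝒞) ∈ R is matched by (a;id , b;id , 𝒞↓id) ∈ u(R).
-- The symmetric halves are reduced to the first ones since flip (u R) and
-- u (flip R) contain the same triples.

open import Defs
open import Level using (lift)
open import Data.Product using (_×_; _,_; proj₂; Σ-syntax)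
open import Data.Product.Function.NonDependent.Propositional using (_×-⇔_)
open import Data.Sum using (_⊎_; inj₁; inj₂; [_,_])
open import Data.Sum.Function.Propositional using (_⊎-⇔_)
open import Data.List using (List; []; _∷_; _++_)
open import Data.List.Relation.Unary.All as All using (All; []; _∷_)
open import Data.List.Relation.Unary.Any as Any using (Any; here; there)
open import Data.List.Membership.Propositional using (lose)
open import Data.Unit.Polymorphic using (tt)
open import Function.Base using (_∘_)
open import Function.Bundles using (_⇔_; mk⇔; Equivalence)
open import Function.Construct.Composition using (_⇔-∘_)
open import Function.Construct.Identity using (⇔-id)
open import Function.Construct.Symmetry using (⇔-sym)
open import Function.Related.Propositional using (module EquationalReasoning)
open import Relation.Binary.PropositionalEquality
  using (_≡_; refl; sym; trans; cong; subst; module ≡-Reasoning)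

open Equivalence using (to; from)

module Lemmas {ℓ} (𝒞 : Cat ℓ) (R𝒦 : Theory.RepSquares 𝒞) (Z : Cat.Obj 𝒞) where
  open Cat 𝒞
  open Theory 𝒞
  open RepSquares R𝒦
  open WithReps R𝒦 Z

  private variable
    A A' B D E K : Obj

  Branch : Obj → Set ℓ
  Branch A = Σ[ A' ∈ Obj ] (Hom A A' × Cond A')

  satAll-++ : (xs ys : List (Branch A)) (a : Hom A B) →
              SatAll (xs ++ ys) a ⇔ (SatAll xs a × SatAll ys a)
  satAll-++ [] ys a = mk⇔ (tt ,_) proj₂
  satAll-++ (_ ∷ xs) ys a =
    mk⇔ (λ (p , s) → let (sx , sy) = to ih s in (p , sx) , sy)
        (λ ((p , sx) , sy) → p , from ih (sx , sy))
    where ih = satAll-++ xs ys a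

  satAny-++ : (xs ys : List (Branch A)) (a : Hom A B) →
              SatAny (xs ++ ys) a ⇔ (SatAny xs a ⊎ SatAny ys a)
  satAny-++ [] ys a = mk⇔ inj₂ [ (λ { (lift ()) }) , (λ s → s) ]
  satAny-++ (_ ∷ xs) ys a =
    mk⇔ [ inj₁ ∘ inj₁ , [ inj₁ ∘ inj₂ , inj₂ ] ∘ to ih ]
        [ [ inj₁ , inj₂ ∘ from ih ∘ inj₁ ] , inj₂ ∘ from ih ∘ inj₂ ]
    where ih = satAny-++ xs ys a

  paste : {h : Hom A A'} {c : Hom A B} {α : Hom A' D} {β : Hom B D}
          {d : Hom B E} {γ : Hom D E} →
          h ⨾ α ≡ c ⨾ β → d ≡ β ⨾ γ → c ⨾ d ≡ h ⨾ (α ⨾ γ)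
  paste {h = h} {c} {α} {β} {d} {γ} square d≡βγ = begin
    c ⨾ d        ≡⟨ cong (c ⨾_) d≡βγ ⟩
    c ⨾ (β ⨾ γ)  ≡⟨ sym (assoc c β γ) ⟩
    (c ⨾ β) ⨾ γ  ≡⟨ cong (_⨾ γ) (sym square) ⟩
    (h ⨾ α) ⨾ γ  ≡⟨ assoc h α γ ⟩
    h ⨾ (α ⨾ γ)  ∎
    where open ≡-Reasoning

  -- For a square (α , β) over (h , c): 𝒜' holds after α for every / for
  -- some factorisation d = β;γ.  These are what the shifted branches of
  -- a condition express about d.
  EveryVia SomeVia : {h : Hom A A'} {c : Hom A B} →
                     Cond A' → Hom B E → Square h c → Set ℓ
  EveryVia 𝒜' d (_ , α , β , _) = ∀ γ → d ≡ β ⨾ γ → Sat 𝒜' (α ⨾ γ)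
  SomeVia  𝒜' d (_ , α , β , _) = Σ[ γ ∈ Hom _ _ ] (d ≡ β ⨾ γ × Sat 𝒜' (α ⨾ γ))

  every-representative : ∀ {A A' B E} (𝒜' : Cond A') (h : Hom A A') (c : Hom A B) (d : Hom B E) →
    All (EveryVia 𝒜' d) (κ h c) ⇔ (∀ g → c ⨾ d ≡ h ⨾ g → Sat 𝒜' g)
  every-representative {A' = A'} {E = E} 𝒜' h c d = mk⇔ restrict extend
    where
    restrict : All (EveryVia 𝒜' d) (κ h c) → ∀ g → c ⨾ d ≡ h ⨾ g → Sat 𝒜' g
    restrict every g cd≡hg with representative h c g d (sym cd≡hg)
    ... | _ , α , β , _ , γ , sq∈κ , g≡αγ , d≡βγ =
      subst (Sat 𝒜') (sym g≡αγ) (All.lookup every sq∈κ γ d≡βγ)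

    extend : (∀ g → c ⨾ d ≡ h ⨾ g → Sat 𝒜' g) → All (EveryVia 𝒜' d) (κ h c)
    extend sat = All.tabulate λ { {_ , α , β , square} _ γ d≡βγ →
                                   sat (α ⨾ γ) (paste square d≡βγ) }

  some-representative : ∀ {A A' B E} (𝒜' : Cond A') (h : Hom A A') (c : Hom A B) (d : Hom B E) →
    Any (SomeVia 𝒜' d) (κ h c) ⇔ (Σ[ g ∈ Hom A' E ] (c ⨾ d ≡ h ⨾ g × Sat 𝒜' g))
  some-representative {A' = A'} {E = E} 𝒜' h c d = mk⇔ forget witness
    where
    forget : Any (SomeVia 𝒜' d) (κ h c) → Σ[ g ∈ Hom A' E ] (c ⨾ d ≡ h ⨾ g × Sat 𝒜' g)
    forget some with Any.satisfied some
    ... | (_ , α , β , square) , γ , d≡βγ , sat = α ⨾ γ , paste square d≡βγ , sat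

    witness : Σ[ g ∈ Hom A' E ] (c ⨾ d ≡ h ⨾ g × Sat 𝒜' g) → Any (SomeVia 𝒜' d) (κ h c)
    witness (g , cd≡hg , sat) with representative h c g d (sym cd≡hg)
    ... | _ , α , β , _ , γ , sq∈κ , g≡αγ , d≡βγ =
      lose sq∈κ (γ , d≡βγ , subst (Sat 𝒜') g≡αγ sat)

  mutual
    sat-shift : (𝒜 : Cond A) (c : Hom A B) (d : Hom B E) →
                Sat (shift 𝒜 c) d ⇔ Sat 𝒜 (c ⨾ d)
    sat-shift (cond ∀Q S) c d = satAll-shift S c d
    sat-shift (cond ∃Q S) c d = satAny-shift S c d

    satAll-shift : (S : List (Branch A)) (c : Hom A B) (d : Hom B E) →
                   SatAll (shiftList S c) d ⇔ SatAll S (c ⨾ d)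
    satAll-shift [] c d = ⇔-id _
    satAll-shift ((_ , h , 𝒜') ∷ S) c d =
      ((every-representative 𝒜' h c d ⇔-∘ satAll-shiftSq 𝒜' (κ h c) d)
         ×-⇔ satAll-shift S c d)
      ⇔-∘ satAll-++ (shiftSq 𝒜' (κ h c)) (shiftList S c) d

    satAny-shift : (S : List (Branch A)) (c : Hom A B) (d : Hom B E) →
                   SatAny (shiftList S c) d ⇔ SatAny S (c ⨾ d)
    satAny-shift [] c d = ⇔-id _
    satAny-shift ((_ , h , 𝒜') ∷ S) c d =
      ((some-representative 𝒜' h c d ⇔-∘ satAny-shiftSq 𝒜' (κ h c) d)
         ⊎-⇔ satAny-shift S c d)
      ⇔-∘ satAny-++ (shiftSq 𝒜' (κ h c)) (shiftList S c) d

    satAll-shiftSq : (𝒜' : Cond A') {h : Hom A A'} {c : Hom A B}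
                     (sqs : List (Square h c)) (d : Hom B E) →
                     SatAll (shiftSq 𝒜' sqs) d ⇔ All (EveryVia 𝒜' d) sqs
    satAll-shiftSq 𝒜' [] d = mk⇔ (λ _ → []) (λ _ → tt)
    satAll-shiftSq 𝒜' ((_ , α , _ , _) ∷ sqs) d =
      mk⇔ (λ (sat , sats) → (λ γ e → to (sat-shift 𝒜' α γ) (sat γ e)) ∷ to rest sats)
          (λ { (sat ∷ sats) → (λ γ e → from (sat-shift 𝒜' α γ) (sat γ e)) , from rest sats })
      where rest = satAll-shiftSq 𝒜' sqs d

    satAny-shiftSq : (𝒜' : Cond A') {h : Hom A A'} {c : Hom A B}
                     (sqs : List (Square h c)) (d : Hom B E) →
                     SatAny (shiftSq 𝒜' sqs) d ⇔ Any (SomeVia 𝒜' d) sqs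
    satAny-shiftSq 𝒜' [] d = mk⇔ (λ { (lift ()) }) (λ ())
    satAny-shiftSq 𝒜' ((_ , α , _ , _) ∷ sqs) d =
      mk⇔ [ (λ (γ , e , sat) → here (γ , e , to (sat-shift 𝒜' α γ) sat)) , there ∘ to rest ]
          (λ { (here (γ , e , sat)) → inj₁ (γ , e , from (sat-shift 𝒜' α γ) sat)
             ; (there some) → inj₂ (from rest some) })
      where rest = satAny-shiftSq 𝒜' sqs d

  shift-shift : (𝒜 : Cond A) (d : Hom A B) (f : Hom B D) (k : Hom D E) →
                Sat (shift (shift 𝒜 d) f) k ⇔ Sat (shift 𝒜 (d ⨾ f)) k
  shift-shift 𝒜 d f k = begin
    Sat (shift (shift 𝒜 d) f) k  ∼⟨ sat-shift (shift 𝒜 d) f k ⟩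
    Sat (shift 𝒜 d) (f ⨾ k)      ∼⟨ sat-shift 𝒜 d (f ⨾ k) ⟩
    Sat 𝒜 (d ⨾ (f ⨾ k))          ≡⟨ cong (Sat 𝒜) (assoc d f k) ⟨
    Sat 𝒜 ((d ⨾ f) ⨾ k)          ∼⟨ ⇔-sym (sat-shift 𝒜 (d ⨾ f) k) ⟩
    Sat (shift 𝒜 (d ⨾ f)) k      ∎
    where open EquationalReasoning

  shift-id : (𝒜 : Cond A) (f : Hom A B) (k : Hom B E) →
             Sat (shift 𝒜 f) k → Sat (shift (shift 𝒜 id) f) k
  shift-id 𝒜 f k = from (shift-shift 𝒜 id f k) ∘ subst (λ g → Sat (shift 𝒜 g) k) (sym (idˡ f))

  _⊆_ : CondRel → CondRel → Set ℓ
  T ⊆ T′ = ∀ {K} {x y : Hom Z K} {D : Cond K} → T x y D → T′ x y D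

  u-flip : (R : CondRel) → flip (u R) ⊆ u (flip R)
  u-flip R (J , a , b , C , r , d , x≡ad , y≡bd , D≡Cd) =
    J , b , a , C , r , d , y≡bd , x≡ad , D≡Cd

  flip-u : (R : CondRel) → u (flip R) ⊆ flip (u R)
  flip-u R = u-flip (flip R)

  record Instance (R : CondRel) (x y : Hom Z K) (D : Cond K) : Set ℓ where
    field
      {J}    : Obj
      {a b}  : Hom Z J
      {C}    : Cond J
      member : R a b C
      d      : Hom J K
      x≡ad   : x ≡ a ⨾ d
      y≡bd   : y ≡ b ⨾ d
      D≡Cd   : D ≡ shift C d

  instance-of : (R : CondRel) {x y : Hom Z K} {D : Cond K} → u R x y D → Instance R x y D
  instance-of R (_ , _ , _ , _ , r , d , x≡ad , y≡bd , D≡Cd) =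
    record { member = r ; d = d ; x≡ad = x≡ad ; y≡bd = y≡bd ; D≡Cd = D≡Cd }

  module WithSystem (𝒮 : ReactiveSystem) where
    open Steps 𝒮

    step-in-context : {a : Hom Z B} {d : Hom B D} {f : Hom D E} {𝒜 : Cond E}
                      {a' : Hom Z E} → CStep (a ⨾ d) f 𝒜 a' ⇔ CStep a (d ⨾ f) 𝒜 a'
    step-in-context {a = a} {d} {f} =
      mk⇔ (λ st → record { CStep st ; eqˡ = trans (sym (assoc a d f)) (CStep.eqˡ st) })
          (λ st → record { CStep st ; eqˡ = trans (assoc a d f) (CStep.eqˡ st) })

    BisimHalf-resp : {T T′ : CondRel} → T ⊆ T′ → T′ ⊆ T → BisimHalf T → BisimHalf T′
    BisimHalf-resp T⊆T′ T′⊆T half t st with half (T′⊆T t) st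
    ... | I , ℬ , b' , C' , steps , answers , ent =
      I , ℬ , b' , C' , steps , (λ i → T⊆T′ (answers i)) , ent

    -- An up-to answer (a''ᵢ , b''ᵢ , 𝒞''ᵢ) with jᵢ is the answer
    -- (a''ᵢ;jᵢ , b''ᵢ;jᵢ , 𝒞''ᵢ↓jᵢ) in u(R); a step of a;d under f is
    -- a step of a under d;f.
    upTo⇒bisimHalf : (R : CondRel) → UpToHalf R → BisimHalf (u R)
    upTo⇒bisimHalf R upTo (_ , _ , _ , C , r , d , refl , refl , refl) {f} st
      with upTo r (to step-in-context st)
    ... | I , ℬ , b' , _ , _ , _ , C'' , j , steps , answers , a'≡ , b'≡ , ent =
      I , ℬ , b' , (λ i → shift (C'' i) (j i)) ,
      (λ i → from step-in-context (steps i)) ,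
      (λ i → _ , _ , _ , _ , answers i , j i , a'≡ i , b'≡ i , refl) ,
      (λ k sat𝒜 satC → ent k sat𝒜 (to (shift-shift C d f k) satC))

    -- (a , b , 𝒞) ∈ R is played as (a;id , b;id , 𝒞↓id) ∈ u(R); every
    -- answer in u(R) is an up-to answer via its generating triple.
    bisimHalf⇒upTo : (R : CondRel) → BisimHalf (u R) → UpToHalf R
    bisimHalf⇒upTo R bisim {a = a} {b} {C} r {f} {𝒜} st
      with bisim (_ , a , b , C , r , id , sym (idʳ a) , sym (idʳ b) , refl) st
    ... | I , ℬ , b' , C' , steps , answers , ent =
      I , ℬ , b' , Gen.J , (λ i → Gen.a i) , (λ i → Gen.b i) , (λ i → Gen.C i) , Gen.d ,
      steps , Gen.member , Gen.x≡ad , Gen.y≡bd , ent′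
      where
      module Gen (i : I) = Instance (instance-of R (answers i))

      ent′ : EntailsOr 𝒜 (shift C f) I (λ i → shift (Gen.C i) (Gen.d i)) ℬ
      ent′ k sat𝒜 satC with ent k sat𝒜 (shift-id C f k satC)
      ... | i , satC' , satℬ = i , subst (λ D → Sat D k) (Gen.D≡Cd i) satC' , satℬ

theorem5p10 : ∀ {ℓ} (𝒞 : Cat ℓ) (κ : Theory.RepSquares 𝒞) (Z : Cat.Obj 𝒞)
                (𝒮 : Theory.WithReps.ReactiveSystem 𝒞 κ Z)
                (R : Theory.WithReps.CondRel 𝒞 κ Z) →
                (Theory.WithReps.Steps.IsBisimUpToContext 𝒞 κ Z 𝒮 R →
                 Theory.WithReps.Steps.IsBisim 𝒞 κ Z 𝒮 (Theory.WithReps.u 𝒞 κ Z R))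
                × (Theory.WithReps.Steps.IsBisim 𝒞 κ Z 𝒮 (Theory.WithReps.u 𝒞 κ Z R) →
                   Theory.WithReps.Steps.IsBisimUpToContext 𝒞 κ Z 𝒮 R)
theorem5p10 𝒞 κ Z 𝒮 R =
    (λ (upTo , upToᶠ) →
         upTo⇒bisimHalf R upTo
       , BisimHalf-resp {u (flip R)} {flip (u R)} (flip-u R) (u-flip R) (upTo⇒bisimHalf (flip R) upToᶠ))
  , (λ (bisim , bisimᶠ) →
         bisimHalf⇒upTo R bisim
       , bisimHalf⇒upTo (flip R) (BisimHalf-resp {flip (u R)} {u (flip R)} (u-flip R) (flip-u R) bisimᶠ))
  where
  open Theory.WithReps 𝒞 κ Z using (flip; u)
  open Lemmas 𝒞 κ Z
  open WithSystem 𝒮
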